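{- Let $f:[n]\to[n]$ be a function and $d$ a positive integer. There exists a set $\mathcal{A}\subseteq\mathcal{S}_n$ with $|\mathcal{A}|\le d$ that $d$-covers $f$.
   Context: $[n]=\{1,\dots,n\}$ and $\mathcal{S}_n$ is the set of permutations of $[n]$. A set $\mathcal{A}\subseteq\mathcal{S}_n$ is said to $d$-cover $f:[n]\to[n]$ if for each $r\in[n]$ at least one of the following holds: (i) there is $\pi\in\mathcal{A}$ with $\pi(r)=f(r)$; or (ii) $|f^{ -1}(f(r))|>d$. -}

module Defs where

open import Data.Nat using (ℕ; _>_)
open import Data.Fin using (Fin; _≟_)
open import Data.Fin.Subset using (Subset; ∣_∣)
open import Data.Fin.Permutation using (Permutation′; _⟨$⟩ʳ_)
open import Data.List using (List)
open import Data.List.Membership.Propositional using (_∈_)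
open import Data.Product using (∃-syntax; _×_)
open import Data.Sum using (_⊎_)
open import Data.Vec using (tabulate)
open import Relation.Binary.PropositionalEquality using (_≡_)
open import Relation.Nullary.Decidable using (⌊_⌋)

preimage : ∀ {n} → (Fin n → Fin n) → Fin n → Subset n
preimage f y = tabulate (λ r → ⌊ f r ≟ y ⌋)

DCovers : ∀ {n} → ℕ → List (Permutation′ n) → (Fin n → Fin n) → Set
DCovers {n} d 𝒜 f =
  (r : Fin n) →
    (∃[ π ] (π ∈ 𝒜 × π ⟨$⟩ʳ r ≡ f r)) ⊎ (∣ preimage f (f r) ∣ > d)

module Submission where

-- Rank each r by the number of earlier elements of its fibre f⁻¹(f r).  Ranks are
-- distinct within a fibre and smaller than its size, so for each i < d the map f
-- restricted to the elements of rank i is injective and extends to a permutation πᵢ.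
-- An r not covered by π₀ … π_{d-1} has rank ≥ d, hence a fibre of size > d.

open import Defs
open import Data.Nat using (ℕ; _≤_; NonZero)
open import Data.Fin using (Fin)
open import Data.Fin.Permutation using (Permutation′)
open import Data.List using (List; length)
open import Data.Product using (∃-syntax; _×_)

open import Data.Bool using (true)
open import Data.Nat as ℕ using (_<_; _<?_)
import Data.Nat.Properties as ℕ
open import Data.Fin using (_≟_) renaming (_<_ to _<ᶠ_; _<?_ to _<ᶠ?_)
open import Data.Fin.Properties using (<-irrefl; <-trans; <-cmp)
open import Data.Fin.Permutation using (_⟨$⟩ʳ_; _⟨$⟩ˡ_; _∘ₚ_; transpose; inverseˡ; id)
open import Data.Fin.Subset using (Subset; _∈_; _∉_; _⊂_; ∣_∣)
open import Data.Fin.Subset.Properties using (p⊂q⇒∣p∣<∣q∣)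
open import Data.List using ([]; _∷_; map; upTo; allFin)
open import Data.List.Properties using (length-map; length-upTo)
import Data.List.Membership.Propositional as List
open import Data.List.Membership.Propositional.Properties using (∈-map⁺; ∈-upTo⁺; ∈-allFin)
open import Data.List.Relation.Unary.Any using (here; there)
open import Data.Product using (_,_; proj₁; proj₂)
open import Data.Sum using (inj₁; inj₂)
open import Data.Vec using (tabulate; lookup)
open import Data.Vec.Properties using (lookup∘tabulate; lookup⇒[]=; []=⇒lookup)
open import Function using (_∘_)
open import Relation.Binary using (tri<; tri≈; tri>)
open import Relation.Binary.PropositionalEquality
  using (_≡_; _≢_; refl; sym; trans; cong; module ≡-Reasoning)
open import Relation.Nullary using (yes; no; contradiction; _×-dec_)
open import Relation.Nullary.Decidable using (⌊_⌋; does; isYes≗does; dec-true; dec-false)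
open import Relation.Unary using (Pred; Decidable)

subset : ∀ {n p} {P : Pred (Fin n) p} → Decidable P → Subset n
subset P? = tabulate (λ x → ⌊ P? x ⌋)

module _ {n p} {P : Pred (Fin n) p} (P? : Decidable P) where

  ∈-subset⁺ : ∀ {x} → P x → x ∈ subset P?
  ∈-subset⁺ {x} px = lookup⇒[]= x _ (begin
    lookup (subset P?) x  ≡⟨ lookup∘tabulate _ x ⟩
    ⌊ P? x ⌋              ≡⟨ isYes≗does (P? x) ⟩
    does (P? x)           ≡⟨ dec-true (P? x) px ⟩
    true                  ∎)
    where open ≡-Reasoning

  ∈-subset⁻ : ∀ {x} → x ∈ subset P? → P x
  ∈-subset⁻ {x} x∈ with P? x | trans (sym (lookup∘tabulate _ x)) ([]=⇒lookup x∈)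
  ... | yes px | _  = px
  ... | no  _  | ()

transpose-ʳ-left : ∀ {n} (i j : Fin n) → transpose i j ⟨$⟩ʳ i ≡ j
transpose-ʳ-left i j rewrite dec-true (i ≟ i) refl = refl

transpose-ʳ-other : ∀ {n} (i j : Fin n) {k} → k ≢ i → k ≢ j → transpose i j ⟨$⟩ʳ k ≡ k
transpose-ʳ-other i j {k} k≢i k≢j rewrite dec-false (k ≟ i) k≢i | dec-false (k ≟ j) k≢j = refl

⟨$⟩ʳ-injective : ∀ {n} (σ : Permutation′ n) {a b} → σ ⟨$⟩ʳ a ≡ σ ⟨$⟩ʳ b → a ≡ b
⟨$⟩ʳ-injective σ {a} {b} eq = begin
  a                    ≡⟨ sym (inverseˡ σ) ⟩
  σ ⟨$⟩ˡ (σ ⟨$⟩ʳ a)   ≡⟨ cong (σ ⟨$⟩ˡ_) eq ⟩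
  σ ⟨$⟩ˡ (σ ⟨$⟩ʳ b)   ≡⟨ inverseˡ σ ⟩
  b                    ∎
  where open ≡-Reasoning

module _ {n p} (g : Fin n → Fin n) {P : Pred (Fin n) p} (P? : Decidable P)
  (injectiveOn : ∀ {r s} → P r → P s → g r ≡ g s → r ≡ s) where

  extendOn : (xs : List (Fin n)) →
    ∃[ σ ] (∀ {s} → s List.∈ xs → P s → σ ⟨$⟩ʳ s ≡ g s)
  extendOn [] = id , λ ()
  extendOn (r ∷ xs) with extendOn xs | P? r
  ... | σ , σ≈g | no ¬pr = σ , λ { (here refl) pr → contradiction pr ¬pr ; (there s∈) → σ≈g s∈ }
  ... | σ , σ≈g | yes pr = σ ∘ₚ transpose (σ ⟨$⟩ʳ r) (g r) , σ′≈g
    where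
    σ′≈g : ∀ {s} → s List.∈ r ∷ xs → P s → transpose (σ ⟨$⟩ʳ r) (g r) ⟨$⟩ʳ (σ ⟨$⟩ʳ s) ≡ g s
    σ′≈g (here refl) _ = transpose-ʳ-left (σ ⟨$⟩ʳ r) (g r)
    σ′≈g {s} (there s∈) ps with s ≟ r
    ... | yes refl = transpose-ʳ-left (σ ⟨$⟩ʳ r) (g r)
    ... | no s≢r = trans
      (transpose-ʳ-other (σ ⟨$⟩ʳ r) (g r)
        (s≢r ∘ ⟨$⟩ʳ-injective σ)
        (s≢r ∘ injectiveOn ps pr ∘ trans (sym (σ≈g s∈ ps))))
      (σ≈g s∈ ps)

  extend : ∃[ σ ] (∀ {s} → P s → σ ⟨$⟩ʳ s ≡ g s)
  extend = let σ , σ≈g = extendOn (allFin n) in σ , σ≈g (∈-allFin _)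

module FibreRank {n} (f : Fin n → Fin n) where

  earlierInFibre : Fin n → Subset n
  earlierInFibre r = subset (λ s → s <ᶠ? r ×-dec f s ≟ f r)

  rank : Fin n → ℕ
  rank r = ∣ earlierInFibre r ∣

  ∈-earlierInFibre⁺ : ∀ {r s} → s <ᶠ r → f s ≡ f r → s ∈ earlierInFibre r
  ∈-earlierInFibre⁺ {r} s<r fs≡fr = ∈-subset⁺ (λ t → t <ᶠ? r ×-dec f t ≟ f r) (s<r , fs≡fr)

  ∈-earlierInFibre⁻ : ∀ {r s} → s ∈ earlierInFibre r → s <ᶠ r × f s ≡ f r
  ∈-earlierInFibre⁻ {r} = ∈-subset⁻ (λ t → t <ᶠ? r ×-dec f t ≟ f r)

  ∉-earlierInFibre : ∀ r → r ∉ earlierInFibre r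
  ∉-earlierInFibre r = <-irrefl refl ∘ proj₁ ∘ ∈-earlierInFibre⁻

  earlierInFibre⊂preimage : ∀ r → earlierInFibre r ⊂ preimage f (f r)
  earlierInFibre⊂preimage r =
      ∈-subset⁺ (λ s → f s ≟ f r) ∘ proj₂ ∘ ∈-earlierInFibre⁻
    , r , ∈-subset⁺ (λ s → f s ≟ f r) refl , ∉-earlierInFibre r

  rank<∣preimage∣ : ∀ r → rank r < ∣ preimage f (f r) ∣
  rank<∣preimage∣ r = p⊂q⇒∣p∣<∣q∣ (earlierInFibre⊂preimage r)

  earlierInFibre-⊂ : ∀ {r s} → r <ᶠ s → f r ≡ f s → earlierInFibre r ⊂ earlierInFibre s
  earlierInFibre-⊂ r<s fr≡fs =
      (λ t∈ → let t<r , ft≡fr = ∈-earlierInFibre⁻ t∈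
              in ∈-earlierInFibre⁺ (<-trans t<r r<s) (trans ft≡fr fr≡fs))
    , _ , ∈-earlierInFibre⁺ r<s fr≡fs , ∉-earlierInFibre _

  rank-monoWithinFibre : ∀ {r s} → r <ᶠ s → f r ≡ f s → rank r < rank s
  rank-monoWithinFibre r<s fr≡fs = p⊂q⇒∣p∣<∣q∣ (earlierInFibre-⊂ r<s fr≡fs)

  rank-injectiveWithinFibre : ∀ {r s} → f r ≡ f s → rank r ≡ rank s → r ≡ s
  rank-injectiveWithinFibre {r} {s} fr≡fs rr≡rs with <-cmp r s
  ... | tri< r<s _ _ = contradiction rr≡rs (ℕ.<⇒≢ (rank-monoWithinFibre r<s fr≡fs))
  ... | tri≈ _ r≡s _ = r≡s
  ... | tri> _ _ s<r = contradiction rr≡rs (ℕ.>⇒≢ (rank-monoWithinFibre s<r (sym fr≡fs)))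

  permutationAtRank : (i : ℕ) → ∃[ σ ] (∀ {r} → rank r ≡ i → σ ⟨$⟩ʳ r ≡ f r)
  permutationAtRank i = extend f (λ r → rank r ℕ.≟ i)
    (λ rᵢ sᵢ fr≡fs → rank-injectiveWithinFibre fr≡fs (trans rᵢ (sym sᵢ)))

lemma2p4 : (n : ℕ) (f : Fin n → Fin n) (d : ℕ) → .{{NonZero d}} →
    ∃[ 𝒜 ] (length {A = Permutation′ n} 𝒜 ≤ d × DCovers d 𝒜 f)
lemma2p4 n f d = map π (upTo d) , length≤d , covers
  where
  open FibreRank f

  π : ℕ → Permutation′ n
  π i = proj₁ (permutationAtRank i)

  length≤d : length (map π (upTo d)) ≤ d
  length≤d = ℕ.≤-reflexive (trans (length-map π (upTo d)) (length-upTo d))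

  covers : DCovers d (map π (upTo d)) f
  covers r with rank r <? d
  ... | yes rank<d = inj₁ (π (rank r) , ∈-map⁺ π (∈-upTo⁺ rank<d) , proj₂ (permutationAtRank (rank r)) refl)
  ... | no rank≮d = inj₂ (ℕ.≤-<-trans (ℕ.≮⇒≥ rank≮d) (rank<∣preimage∣ r))
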